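{- If $s$ is a store term with nonempty $\mathrm{dom}(s)=\{\ell_1,\ldots,\ell_n\}$ (the $\ell_i$ pairwise distinct), then there exist values $V_1,\ldots,V_n$ such that \[\vdash s=\mathrm{upd}_{\ell_1}(V_1,\cdots\mathrm{upd}_{\ell_n}(V_n,\mathrm{emp})\cdots).\] Consequently, the equational theory of store and lookup terms (i.e. the relation $\vdash s=t$) is decidable.
   Context: Fix a countably infinite set $\mathbf{L}$ of locations. Values are the terms $V ::= x\mid\lambda x.M$ of an untyped calculus, considered up to renaming of bound variables (syntactic identity of values is decidable). Store terms $s,t ::= \mathrm{emp} \mid \mathrm{upd}_\ell(u,s)$ and lookup terms $u ::= V \mid \mathrm{lkp}_\ell(s)$ ($\ell\in\mathbf{L}$), where $\mathrm{lkp}_\ell(s)$ is well formed only if $\ell\in\mathrm{dom}(s)$; $\mathrm{dom}(\mathrm{emp})=\emptyset$, $\mathrm{dom}(\mathrm{upd}_\ell(u,s))=\{\ell\}\cup\mathrm{dom}(s)$. $\vdash a=b$ means the equation is derivable in equational logic (reflexivity, symmetry, transitivity, congruence) from: (1) $\mathrm{lkp}_\ell(\mathrm{upd}_\ell(u,s))=u$; (2) $\mathrm{lkp}_\ell(\mathrm{upd}_{\ell'}(u,s))=\mathrm{lkp}_\ell(s)$ if $\ell\neq\ell'$; (3) $\mathrm{upd}_\ell(\mathrm{lkp}_\ell(s),s)=s$; (4) $\mathrm{upd}_\ell(U,\mathrm{upd}_\ell(W,s))=\mathrm{upd}_\ell(U,s)$; (5) $\mathrm{upd}_\ell(U,\mathrm{upd}_{\ell'}(W,s))=\mathrm{upd}_{\ell'}(W,\mathrm{upd}_\ell(U,s))$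 if $\ell\ne\ell'$ ($U,W$ values). -}

module Defs where

open import Data.Nat using (ℕ; _≟_)
open import Data.Bool using (Bool; true; false; _∨_; T)
open import Data.List using (List; []; _∷_; length)
open import Data.Vec using (Vec; []; _∷_)
open import Relation.Nullary using (¬_; does)
open import Relation.Binary.PropositionalEquality using (_≡_)

Loc : Set
Loc = ℕ

-- Untyped λ-terms in de Bruijn notation (so α-equivalence is syntactic identity).
data Term : Set where
  var : ℕ → Term
  lam : Term → Term
  app : Term → Term → Term

data Value : Set where
  vvar : ℕ → Value
  vlam : Term → Value

-- Store terms and lookup terms, with the domain membership test defined
-- simultaneously (induction-recursion); lkp ℓ s is only formed when ℓ ∈ dom(s).
data Store : Set
data Lkp : Set
_∈dom?_ : Loc → Store → Bool

data Store where
  emp : Store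
  upd : Loc → Lkp → Store → Store

data Lkp where
  val : Value → Lkp
  lkp : (ℓ : Loc) (s : Store) → T (ℓ ∈dom? s) → Lkp

ℓ ∈dom? emp = false
ℓ ∈dom? upd ℓ' u s = does (ℓ ≟ ℓ') ∨ (ℓ ∈dom? s)

_∈dom_ : Loc → Store → Set
ℓ ∈dom s = T (ℓ ∈dom? s)

data ⊢s_≈_ : Store → Store → Set
data ⊢u_≈_ : Lkp → Lkp → Set

data ⊢s_≈_ where
  s-refl  : ∀ {s} → ⊢s s ≈ s
  s-sym   : ∀ {s t} → ⊢s s ≈ t → ⊢s t ≈ s
  s-trans : ∀ {s t r} → ⊢s s ≈ t → ⊢s t ≈ r → ⊢s s ≈ r
  s-upd   : ∀ {ℓ u u' s s'} → ⊢u u ≈ u' → ⊢s s ≈ s' → ⊢s upd ℓ u s ≈ upd ℓ u' s'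
  ax3 : ∀ {ℓ s} (p : ℓ ∈dom s) → ⊢s upd ℓ (lkp ℓ s p) s ≈ s
  ax4 : ∀ {ℓ U W s} → ⊢s upd ℓ (val U) (upd ℓ (val W) s) ≈ upd ℓ (val U) s
  ax5 : ∀ {ℓ ℓ' U W s} → ¬ (ℓ ≡ ℓ') →
        ⊢s upd ℓ (val U) (upd ℓ' (val W) s) ≈ upd ℓ' (val W) (upd ℓ (val U) s)

data ⊢u_≈_ where
  u-refl  : ∀ {u} → ⊢u u ≈ u
  u-sym   : ∀ {u v} → ⊢u u ≈ v → ⊢u v ≈ u
  u-trans : ∀ {u v w} → ⊢u u ≈ v → ⊢u v ≈ w → ⊢u u ≈ w
  u-lkp   : ∀ {ℓ s t} (p : ℓ ∈dom s) (q : ℓ ∈dom t) → ⊢s s ≈ t → ⊢u lkp ℓ s p ≈ lkp ℓ t q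
  ax1 : ∀ {ℓ u s} (p : ℓ ∈dom upd ℓ u s) → ⊢u lkp ℓ (upd ℓ u s) p ≈ u
  ax2 : ∀ {ℓ ℓ' u s} → ¬ (ℓ ≡ ℓ') → (p : ℓ ∈dom upd ℓ' u s) (q : ℓ ∈dom s) →
        ⊢u lkp ℓ (upd ℓ' u s) p ≈ lkp ℓ s q

updChain : (ls : List Loc) → Vec Value (length ls) → Store
updChain []       []       = emp
updChain (ℓ ∷ ls) (V ∷ Vs) = upd ℓ (val V) (updChain ls Vs)

module Submission where

-- A store denotes a finite partial map ⟦ s ⟧ : Loc ⇀ Value, and every axiom holds in this
-- model, so derivable equality is sound. Conversely every store is derivably equal to the
-- chain of updates over its domain carrying the values it denotes: lookups evaluate by (1)
-- and (2), an update shadows older updates of the same location by (4) and (5), and (5)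
-- permutes the chain freely. Hence ⊢ s = t holds exactly when ⟦ s ⟧ = ⟦ t ⟧, which is
-- decidable by comparing the two maps on the union of the (finite) domains.

open import Defs
open import Data.Bool using (true; false; T; if_then_else_)
open import Data.Empty using (⊥-elim)
open import Data.List using (List; []; _∷_; _++_; filter)
open import Data.List.Membership.Propositional using (_∈_)
open import Data.List.Membership.Propositional.Properties using (∈-filter⁺; ∈-filter⁻; ∈-++⁺ˡ; ∈-++⁺ʳ)
open import Data.List.Membership.Propositional.Properties.WithK using (unique∧set⇒bag)
open import Data.Nat using (_≟_)
open import Data.List.Membership.DecPropositional _≟_ using (_∈?_)
open import Data.List.Relation.Binary.BagAndSetEquality using (∼bag⇒↭)
open import Data.List.Relation.Binary.Permutation.Propositional as ↭ using (_↭_)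
open import Data.List.Relation.Unary.All as All using (All)
open import Data.List.Relation.Unary.All.Properties using (all-filter)
open import Data.List.Relation.Unary.AllPairs using ([]; _∷_)
open import Data.List.Relation.Unary.Any using (here; there)
open import Data.List.Relation.Unary.Unique.Propositional using (Unique)
open import Data.List.Relation.Unary.Unique.Propositional.Properties using (filter⁺)
open import Data.Maybe using (Maybe; just; nothing; is-just; fromMaybe)
import Data.Maybe.Properties as Maybe
open import Data.Product using (_×_; ∃-syntax; _,_; proj₁; proj₂; uncurry)
open import Data.Vec using (fromList; map)
open import Function using (_∘_)
open import Function.Bundles using (_⇔_; mk⇔; Equivalence)
import Function.Properties.Equivalence as ⇔
open import Relation.Binary.Bundles using (Setoid)
open import Relation.Binary.Definitions using (DecidableEquality)
open import Relation.Binary.PropositionalEquality as ≡ using (_≡_; _≢_; _≗_; cong; cong₂; subst)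
import Relation.Binary.Reasoning.Setoid as SetoidReasoning
open import Relation.Nullary using (¬_; Dec; yes; no; does; proof; ofʸ; ofⁿ; ¬?; contradiction)
open import Relation.Nullary.Decidable using (map′; _×-dec_)

_≟ᵀ_ : DecidableEquality Term
var x   ≟ᵀ var y   = map′ (cong var) (λ { ≡.refl → ≡.refl }) (x ≟ y)
lam M   ≟ᵀ lam N   = map′ (cong lam) (λ { ≡.refl → ≡.refl }) (M ≟ᵀ N)
app M P ≟ᵀ app N Q = map′ (uncurry (cong₂ app)) (λ { ≡.refl → ≡.refl , ≡.refl }) (M ≟ᵀ N ×-dec P ≟ᵀ Q)
var _   ≟ᵀ lam _   = no λ ()
var _   ≟ᵀ app _ _ = no λ ()
lam _   ≟ᵀ var _   = no λ ()
lam _   ≟ᵀ app _ _ = no λ ()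
app _ _ ≟ᵀ var _   = no λ ()
app _ _ ≟ᵀ lam _   = no λ ()

_≟ⱽ_ : DecidableEquality Value
vvar x ≟ⱽ vvar y = map′ (cong vvar) (λ { ≡.refl → ≡.refl }) (x ≟ y)
vlam M ≟ⱽ vlam N = map′ (cong vlam) (λ { ≡.refl → ≡.refl }) (M ≟ᵀ N)
vvar _ ≟ⱽ vlam _ = no λ ()
vlam _ ≟ⱽ vvar _ = no λ ()

⟦_⟧  : Store → Loc → Maybe Value
_[_] : Store → Loc → Value
eval : Lkp → Value

⟦ emp ⟧       k = nothing
⟦ upd ℓ u s ⟧ k = if does (k ≟ ℓ) then just (eval u) else ⟦ s ⟧ k

-- vvar 0 is a junk default: it is only read off the domain, where no well-formed lookup points.
s [ ℓ ] = fromMaybe (vvar 0) (⟦ s ⟧ ℓ)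

eval (val V)     = V
eval (lkp ℓ s _) = s [ ℓ ]

-- Case splits that must rewrite the goal abstract does (k ≟ ℓ), not k ≟ ℓ: the latter
-- reduces to a record over k ≡ᵇ ℓ, so it never occurs in a normalised goal.
[upd]-here : ∀ ℓ u s → upd ℓ u s [ ℓ ] ≡ eval u
[upd]-here ℓ u s with does (ℓ ≟ ℓ) | proof (ℓ ≟ ℓ)
... | true  | _        = ≡.refl
... | false | ofⁿ ℓ≢ℓ = contradiction ≡.refl ℓ≢ℓ

[upd]-there : ∀ {k ℓ} u s → k ≢ ℓ → upd ℓ u s [ k ] ≡ s [ k ]
[upd]-there {k} {ℓ} u s k≢ℓ with does (k ≟ ℓ) | proof (k ≟ ℓ)
... | true  | ofʸ k≡ℓ = contradiction k≡ℓ k≢ℓ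
... | false | _       = ≡.refl

∈dom?≡is-just : ∀ s ℓ → ℓ ∈dom? s ≡ is-just (⟦ s ⟧ ℓ)
∈dom?≡is-just emp         ℓ = ≡.refl
∈dom?≡is-just (upd k u s) ℓ with does (ℓ ≟ k)
... | true  = ≡.refl
... | false = ∈dom?≡is-just s ℓ

defined-on-dom : ∀ s {ℓ} → ℓ ∈dom s → just (s [ ℓ ]) ≡ ⟦ s ⟧ ℓ
defined-on-dom s {ℓ} ℓ∈ with ⟦ s ⟧ ℓ | ∈dom?≡is-just s ℓ
... | just _  | _  = ≡.refl
... | nothing | eq = ⊥-elim (subst T eq ℓ∈)

undefined-off-dom : ∀ s {ℓ} → ¬ ℓ ∈dom s → ⟦ s ⟧ ℓ ≡ nothing
undefined-off-dom s {ℓ} ℓ∉ with ⟦ s ⟧ ℓ | ∈dom?≡is-just s ℓ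
... | just _  | eq = contradiction (subst T (≡.sym eq) _) ℓ∉
... | nothing | _  = ≡.refl

∈dom-resp-≗ : ∀ s t → ⟦ s ⟧ ≗ ⟦ t ⟧ → ∀ ℓ → ℓ ∈dom s ⇔ ℓ ∈dom t
∈dom-resp-≗ s t s≗t ℓ = mk⇔ (subst T same-dom) (subst T (≡.sym same-dom))
  where
  same-dom : ℓ ∈dom? s ≡ ℓ ∈dom? t
  same-dom = ≡.trans (∈dom?≡is-just s ℓ) (≡.trans (cong is-just (s≗t ℓ)) (≡.sym (∈dom?≡is-just t ℓ)))

∈dom-upd-here : ∀ {ℓ} u s → ℓ ∈dom upd ℓ u s
∈dom-upd-here {ℓ} _ _ with does (ℓ ≟ ℓ) | proof (ℓ ≟ ℓ)
... | true  | _        = _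
... | false | ofⁿ ℓ≢ℓ = contradiction ≡.refl ℓ≢ℓ

∈dom-upd-there : ∀ {ℓ k} u s → ℓ ∈dom s → ℓ ∈dom upd k u s
∈dom-upd-there {ℓ} {k} _ _ ℓ∈ with does (ℓ ≟ k)
... | true  = _
... | false = ℓ∈

∈dom-upd⁻ : ∀ {ℓ k} u s → ℓ ≢ k → ℓ ∈dom upd k u s → ℓ ∈dom s
∈dom-upd⁻ {ℓ} {k} _ _ ℓ≢k ℓ∈ with does (ℓ ≟ k) | proof (ℓ ≟ k)
... | true  | ofʸ ℓ≡k = contradiction ℓ≡k ℓ≢k
... | false | _       = ℓ∈

⊢s-sound : ∀ {s t} → ⊢s s ≈ t → ⟦ s ⟧ ≗ ⟦ t ⟧
⊢u-sound : ∀ {u v} → ⊢u u ≈ v → eval u ≡ eval v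

⊢s-sound s-refl        k = ≡.refl
⊢s-sound (s-sym d)     k = ≡.sym (⊢s-sound d k)
⊢s-sound (s-trans d e) k = ≡.trans (⊢s-sound d k) (⊢s-sound e k)
⊢s-sound (s-upd {ℓ} du ds) k with does (k ≟ ℓ)
... | true  = cong just (⊢u-sound du)
... | false = ⊢s-sound ds k
⊢s-sound (ax3 {ℓ} {s} ℓ∈) k with does (k ≟ ℓ) | proof (k ≟ ℓ)
... | true  | ofʸ ≡.refl = defined-on-dom s ℓ∈
... | false | _          = ≡.refl
⊢s-sound (ax4 {ℓ}) k with does (k ≟ ℓ)
... | true  = ≡.refl
... | false = ≡.refl
⊢s-sound (ax5 {ℓ} {ℓ′} ℓ≢ℓ′) k with does (k ≟ ℓ) | proof (k ≟ ℓ) | does (k ≟ ℓ′) | proof (k ≟ ℓ′)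
... | false | _          | _     | _          = ≡.refl
... | true  | _          | false | _          = ≡.refl
... | true  | ofʸ ≡.refl | true  | ofʸ ≡.refl = contradiction ≡.refl ℓ≢ℓ′

⊢u-sound u-refl                     = ≡.refl
⊢u-sound (u-sym d)                  = ≡.sym (⊢u-sound d)
⊢u-sound (u-trans d e)              = ≡.trans (⊢u-sound d) (⊢u-sound e)
⊢u-sound (u-lkp {ℓ} _ _ d)          = cong (fromMaybe _) (⊢s-sound d ℓ)
⊢u-sound (ax1 {ℓ} {u} {s} _)       = [upd]-here ℓ u s
⊢u-sound (ax2 {u = u} {s} ℓ≢ℓ′ _ _) = [upd]-there u s ℓ≢ℓ′

⊢s-setoid : Setoid _ _
⊢s-setoid = record
  { Carrier       = Store
  ; _≈_           = ⊢s_≈_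
  ; isEquivalence = record { refl = s-refl ; sym = s-sym ; trans = s-trans }
  }

open SetoidReasoning ⊢s-setoid

chain : List Loc → (Loc → Value) → Store
chain ls g = updChain ls (map g (fromList ls))

chain-cong : ∀ {ls g h} → (∀ {k} → k ∈ ls → g k ≡ h k) → chain ls g ≡ chain ls h
chain-cong {[]}     g≡h = ≡.refl
chain-cong {k ∷ ls} g≡h = cong₂ (upd k ∘ val) (g≡h (here ≡.refl)) (chain-cong (g≡h ∘ there))

chain-↭ : ∀ {ls ks g} → ls ↭ ks → ⊢s chain ls g ≈ chain ks g
chain-↭ ↭.refl         = s-refl
chain-↭ (↭.prep _ p)   = s-upd u-refl (chain-↭ p)
chain-↭ (↭.swap x y p) with x ≟ y
... | yes ≡.refl = s-upd u-refl (s-upd u-refl (chain-↭ p))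
... | no x≢y     = s-trans (s-upd u-refl (s-upd u-refl (chain-↭ p))) (ax5 x≢y)
chain-↭ (↭.trans p q)  = s-trans (chain-↭ p) (chain-↭ q)

lkp-chain : ∀ {ℓ g} ls (ℓ∈ : ℓ ∈dom chain ls g) → ⊢u lkp ℓ (chain ls g) ℓ∈ ≈ val (g ℓ)
lkp-chain []                  ()
lkp-chain {ℓ} {g} (k ∷ ls) ℓ∈ with ℓ ≟ k
... | yes ≡.refl = ax1 ℓ∈
... | no ℓ≢k     = u-trans (ax2 ℓ≢k ℓ∈ ℓ∈ls) (lkp-chain ls ℓ∈ls)
  where ℓ∈ls = ∈dom-upd⁻ (val (g k)) (chain ls g) ℓ≢k ℓ∈

_≢?_ : ∀ k ℓ → Dec (k ≢ ℓ)
k ≢? ℓ = ¬? (k ≟ ℓ)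

_∖_ : List Loc → Loc → List Loc
ls ∖ ℓ = filter (_≢? ℓ) ls

upd-chain-∖ : ∀ {ℓ V g} ls → ⊢s upd ℓ (val V) (chain ls g) ≈ upd ℓ (val V) (chain (ls ∖ ℓ) g)
upd-chain-∖ [] = s-refl
upd-chain-∖ {ℓ} {V} {g} (k ∷ ls) with does (k ≟ ℓ) | proof (k ≟ ℓ)
... | true  | ofʸ ≡.refl = s-trans ax4 (upd-chain-∖ ls)
... | false | ofⁿ k≢ℓ   = begin
  upd ℓ (val V) (upd k (val (g k)) (chain ls g))       ≈⟨ ax5 ℓ≢k ⟩
  upd k (val (g k)) (upd ℓ (val V) (chain ls g))       ≈⟨ s-upd u-refl (upd-chain-∖ ls) ⟩
  upd k (val (g k)) (upd ℓ (val V) (chain (ls ∖ ℓ) g)) ≈⟨ ax5 ℓ≢k ⟨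
  upd ℓ (val V) (upd k (val (g k)) (chain (ls ∖ ℓ) g)) ∎
  where ℓ≢k = k≢ℓ ∘ ≡.sym

dom-list : Store → List Loc
dom-list emp         = []
dom-list (upd ℓ _ s) = ℓ ∷ dom-list s ∖ ℓ

dom-list-unique : ∀ s → Unique (dom-list s)
dom-list-unique emp         = []
dom-list-unique (upd ℓ _ s) =
  All.map (_∘ ≡.sym) (all-filter (_≢? ℓ) (dom-list s)) ∷ filter⁺ _ (dom-list-unique s)

∈dom-list⇔∈dom : ∀ s {ℓ} → ℓ ∈ dom-list s ⇔ ℓ ∈dom s
∈dom-list⇔∈dom s = mk⇔ (to s) (from s)
  where
  to : ∀ s {ℓ} → ℓ ∈ dom-list s → ℓ ∈dom s
  to emp         ()
  to (upd k u s) (here ≡.refl) = ∈dom-upd-here u s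
  to (upd k u s) (there ℓ∈)    = ∈dom-upd-there u s (to s (proj₁ (∈-filter⁻ (_≢? k) ℓ∈)))
  from : ∀ s {ℓ} → ℓ ∈dom s → ℓ ∈ dom-list s
  from emp         ()
  from (upd k u s) {ℓ} ℓ∈ with ℓ ≟ k
  ... | yes ≡.refl = here ≡.refl
  ... | no ℓ≢k     = there (∈-filter⁺ (_≢? k) (from s (∈dom-upd⁻ u s ℓ≢k ℓ∈)) ℓ≢k)

chain-dom-list : ∀ s → ⊢s s ≈ chain (dom-list s) (s [_])
eval-derivable : ∀ u → ⊢u u ≈ val (eval u)

chain-dom-list emp         = s-refl
chain-dom-list (upd ℓ u s) = begin
  upd ℓ u s                                             ≈⟨ s-upd (eval-derivable u) (chain-dom-list s) ⟩
  upd ℓ (val (eval u)) (chain (dom-list s) (s [_]))     ≈⟨ upd-chain-∖ (dom-list s) ⟩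
  upd ℓ (val (eval u)) (chain (dom-list s ∖ ℓ) (s [_])) ≡⟨ cong₂ (upd ℓ ∘ val) at-ℓ (chain-cong off-ℓ) ⟩
  chain (dom-list (upd ℓ u s)) (upd ℓ u s [_])          ∎
  where
  at-ℓ : eval u ≡ upd ℓ u s [ ℓ ]
  at-ℓ = ≡.sym ([upd]-here ℓ u s)
  off-ℓ : ∀ {k} → k ∈ dom-list s ∖ ℓ → s [ k ] ≡ upd ℓ u s [ k ]
  off-ℓ k∈ = ≡.sym ([upd]-there u s (proj₂ (∈-filter⁻ (_≢? ℓ) {xs = dom-list s} k∈)))

eval-derivable (val V)      = u-refl
eval-derivable (lkp ℓ s ℓ∈) =
  u-trans (u-lkp ℓ∈ ℓ∈chain (chain-dom-list s)) (lkp-chain (dom-list s) ℓ∈chain)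
  where ℓ∈chain = Equivalence.to (∈dom-resp-≗ s (chain (dom-list s) (s [_])) (⊢s-sound (chain-dom-list s)) ℓ) ℓ∈

normal-form : ∀ s ls → Unique ls → (∀ ℓ → ℓ ∈ ls ⇔ ℓ ∈dom s) → ⊢s s ≈ chain ls (s [_])
normal-form s ls uniq ls⇔dom = s-trans (chain-dom-list s) (chain-↭ dom-list↭ls)
  where
  dom-list↭ls : dom-list s ↭ ls
  dom-list↭ls = ∼bag⇒↭ (unique∧set⇒bag (dom-list-unique s) uniq
    (λ {ℓ} → ⇔.trans (∈dom-list⇔∈dom s) (⇔.sym (ls⇔dom ℓ))))

⊢s-complete : ∀ {s t} → ⟦ s ⟧ ≗ ⟦ t ⟧ → ⊢s s ≈ t
⊢s-complete {s} {t} s≗t = begin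
  s                          ≈⟨ chain-dom-list s ⟩
  chain (dom-list s) (s [_]) ≡⟨ chain-cong (λ {k} _ → cong (fromMaybe _) (s≗t k)) ⟩
  chain (dom-list s) (t [_]) ≈⟨ normal-form t (dom-list s) (dom-list-unique s) dom-list⇔dom-t ⟨
  t                          ∎
  where
  dom-list⇔dom-t : ∀ ℓ → ℓ ∈ dom-list s ⇔ ℓ ∈dom t
  dom-list⇔dom-t ℓ = ⇔.trans (∈dom-list⇔∈dom s) (∈dom-resp-≗ s t s≗t ℓ)

⊢u-complete : ∀ {u v} → eval u ≡ eval v → ⊢u u ≈ v
⊢u-complete {u} {v} u≡v =
  u-trans (eval-derivable u) (subst (λ V → ⊢u val V ≈ v) (≡.sym u≡v) (u-sym (eval-derivable v)))

≗-dec : ∀ s t → Dec (⟦ s ⟧ ≗ ⟦ t ⟧)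
≗-dec s t = map′ everywhere (λ s≗t → All.tabulate (λ {k} _ → s≗t k))
  (All.all? (λ k → Maybe.≡-dec _≟ⱽ_ (⟦ s ⟧ k) (⟦ t ⟧ k)) support)
  where
  support : List Loc
  support = dom-list s ++ dom-list t
  everywhere : All (λ k → ⟦ s ⟧ k ≡ ⟦ t ⟧ k) support → ⟦ s ⟧ ≗ ⟦ t ⟧
  everywhere agree k with k ∈? support
  ... | yes k∈ = All.lookup agree k∈
  ... | no k∉  = ≡.trans (undefined-off-dom s (k∉ ∘ ∈-++⁺ˡ ∘ Equivalence.from (∈dom-list⇔∈dom s)))
                   (≡.sym (undefined-off-dom t (k∉ ∘ ∈-++⁺ʳ _ ∘ Equivalence.from (∈dom-list⇔∈dom t))))

mainTheorem7 : ((s : Store) (ls : List Loc) → ¬ (ls ≡ []) → Unique ls → (∀ ℓ → (ℓ ∈ ls) ⇔ (ℓ ∈dom s)) →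
    ∃[ Vs ] (⊢s s ≈ updChain ls Vs))
    × ((s t : Store) → Dec (⊢s s ≈ t))
    × ((u v : Lkp) → Dec (⊢u u ≈ v))
mainTheorem7 =
    (λ s ls _ uniq ls⇔dom → map (s [_]) (fromList ls) , normal-form s ls uniq ls⇔dom)
  , (λ s t → map′ ⊢s-complete ⊢s-sound (≗-dec s t))
  , (λ u v → map′ ⊢u-complete ⊢u-sound (eval u ≟ⱽ eval v))
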